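{- For every integer $r\geq 2$, if $G$ is a connected $(K_2\cup rK_1)$-free graph, then $\rho^o(G)\leq \max\{r+1,\,2(r-1)\}$.
   Context: All graphs are finite, simple and undirected. For $x\in V(G)$, $N(x)$ is the set of neighbours of $x$. A vertex subset $S$ of $G$ is an open packing if $N(x)\cap N(y)=\emptyset$ for every pair of distinct $x,y\in S$; $\rho^o(G)$ is the maximum size of an open packing. A graph is $H$-free if it has no induced subgraph isomorphic to $H$. $K_2$ is a single edge, $rK_1$ the edgeless graph on $r$ vertices, and $\cup$ denotes disjoint union. -}

module Defs where

open import Data.Nat using (ℕ; zero; suc; _+_; _≤_; _⊔_; _∸_; _*_)
open import Data.Fin using (Fin; zero; suc)
open import Data.Fin.Subset using (Subset; _∈_; ∣_∣)
open import Data.Bool using (Bool; true; false)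
open import Data.Product using (Σ; _×_; _,_; ∃)
open import Data.Empty using (⊥)
open import Relation.Nullary using (¬_)
open import Relation.Binary.PropositionalEquality using (_≡_; _≢_)
open import Function.Definitions using (Injective)

record Graph (n : ℕ) : Set₁ where
  field
    Adj      : Fin n → Fin n → Set
    sym      : ∀ {x y} → Adj x y → Adj y x
    irrefl   : ∀ {x} → ¬ Adj x x

open Graph public

data Reach {n : ℕ} (G : Graph n) : Fin n → Fin n → Set where
  here : ∀ {x} → Reach G x x
  step : ∀ {x y z} → Adj G x y → Reach G y z → Reach G x z

Connected : ∀ {n} → Graph n → Set
Connected {n} G = (x y : Fin n) → Reach G x y

InducedSubgraph : ∀ {m n} → Graph m → Graph n → Set
InducedSubgraph {m} {n} H G =
  Σ (Fin m → Fin n) λ f →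
    Injective _≡_ _≡_ f ×
    (∀ x y → (Adj H x y → Adj G (f x) (f y)) × (Adj G (f x) (f y) → Adj H x y))

Free : ∀ {m n} → Graph m → Graph n → Set
Free H G = ¬ InducedSubgraph H G

data K2rK1-Adj {r : ℕ} : Fin (2 + r) → Fin (2 + r) → Set where
  e01 : K2rK1-Adj zero (suc zero)
  e10 : K2rK1-Adj (suc zero) zero

K2∪rK1 : (r : ℕ) → Graph (2 + r)
K2∪rK1 r = record
  { Adj = K2rK1-Adj {r}
  ; sym = λ { e01 → e10 ; e10 → e01 }
  ; irrefl = λ ()
  }

N : ∀ {n} → Graph n → Fin n → Fin n → Set
N G x z = Adj G x z

OpenPacking : ∀ {n} → Graph n → Subset n → Set
OpenPacking {n} G S =
  ∀ x y → x ∈ S → y ∈ S → x ≢ y → ∀ z → ¬ (N G x z × N G y z)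

ρᵒ≤ : ∀ {n} → Graph n → ℕ → Set
ρᵒ≤ {n} G k = ∀ (S : Subset n) → OpenPacking G S → ∣ S ∣ ≤ k

-- Let E be an open packing with |E| > max(r+1, 2(r-1)). No two members of E share a
-- neighbour, so the subgraph induced by E is a matching plus isolated vertices, and a
-- neighbour of a member of E is adjacent to no other member. If E spans two disjoint
-- edges uv and pq, connectivity gives an edge pc leaving {p, q}; then uv together with
-- c, q and an independent half of E ∖ {u, v, p, q} induces K₂ ∪ rK₁. Otherwise some
-- w ∈ E is isolated in E, connectivity gives an edge wc with c ∉ E, and wc together with
-- E minus w and one endpoint of the (at most one) edge of E induces K₂ ∪ rK₁.
-- Adjacency need not be decidable, but it is ¬¬-decidable, which suffices to derive ⊥.
module Submission where

open import Defs
open import Data.Nat using (ℕ; zero; suc; _+_; _*_; _∸_; _⊔_; _≤_; _<_; z≤n; s≤s; _≤?_)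
open import Data.Nat.Properties
  using ( ≤-refl; ≤-trans; ≤-reflexive; ≤-pred; +-suc; +-identityʳ; +-cancelˡ-≤; +-monoʳ-≤
        ; <⇒≱; ≰⇒>; m⊔n<o⇒m<o; m⊔n<o⇒n<o; module ≤-Reasoning )
open import Data.Nat.Tactic.RingSolver using (solve-∀)
open import Data.Fin using (Fin; zero; suc; inject≤; _≟_)
open import Data.Fin.Properties using (inject≤-injective; suc-injective)
open import Data.Fin.Subset using (Subset; ∣_∣) renaming (_∈_ to _∈ₛ_)
open import Data.Vec.Base using ([]; _∷_; here; there)
open import Data.Bool using (true; false)
open import Data.List using (List; []; _∷_; length; map; lookup; filter)
open import Data.List.Properties using (length-map; length-filter; filter-all)
open import Data.List.Membership.Propositional using (_∈_; find; lose)
open import Data.List.Membership.Propositional.Properties using (∈-map⁻; ∈-lookup; ∈-filter⁻)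
open import Data.List.Relation.Binary.Subset.Propositional using (_⊆_)
open import Data.List.Relation.Unary.Any using (here; there; any?)
open import Data.List.Relation.Unary.All as All using (All; []; _∷_)
open import Data.List.Relation.Unary.Unique.Propositional using (Unique; []; _∷_)
open import Data.List.Relation.Unary.Unique.Propositional.Properties using (map⁺; filter⁺)
open import Data.Product using (_×_; _,_; proj₁; proj₂; ∃; ∃₂)
open import Data.Empty using (⊥; ⊥-elim)
open import Function using (_∘_)
open import Relation.Nullary using (¬_; Dec; yes; no; ¬?)
open import Relation.Nullary.Decidable using (decidable-stable; ¬¬-excluded-middle)
open import Relation.Binary.Definitions using (Decidable; DecidableEquality)
open import Relation.Binary.PropositionalEquality as ≡ using (_≡_; _≢_; refl; cong; subst)

¬¬-∀-Fin : ∀ {m} {P : Fin m → Set} → (∀ i → ¬ ¬ P i) → ¬ ¬ (∀ i → P i)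
¬¬-∀-Fin {zero}  _   ¬∀ = ¬∀ λ ()
¬¬-∀-Fin {suc m} ¬¬P ¬∀ = ¬¬P zero λ P0 → ¬¬-∀-Fin (¬¬P ∘ suc) λ Psuc →
  ¬∀ λ { zero → P0 ; (suc i) → Psuc i }

¬¬-decidable-Fin : ∀ {m} (R : Fin m → Fin m → Set) → ¬ ¬ Decidable R
¬¬-decidable-Fin R = ¬¬-∀-Fin λ x → ¬¬-∀-Fin λ y → ¬¬-excluded-middle

m+m≤1+n+n⇒m≤n : ∀ m n → m + m ≤ suc (n + n) → m ≤ n
m+m≤1+n+n⇒m≤n zero    n       _ = z≤n
m+m≤1+n+n⇒m≤n (suc m) zero    (s≤s le) with () ← subst (_≤ 0) (+-suc m m) le
m+m≤1+n+n⇒m≤n (suc m) (suc n) le rewrite +-suc m m | +-suc n n =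
  s≤s (m+m≤1+n+n⇒m≤n m n (≤-pred (≤-pred le)))

lookup-injective : ∀ {A : Set} {xs : List A} → Unique xs → ∀ i j → lookup xs i ≡ lookup xs j → i ≡ j
lookup-injective (_   ∷ _) zero    zero    _ = refl
lookup-injective (x∉ ∷ _) zero    (suc j) e = ⊥-elim (All.lookup x∉ (∈-lookup j) e)
lookup-injective (x∉ ∷ _) (suc i) zero    e = ⊥-elim (All.lookup x∉ (∈-lookup i) (≡.sym e))
lookup-injective (_   ∷ u) (suc i) (suc j) e = cong suc (lookup-injective u i j e)

length≤1+length-filter : ∀ {A : Set} {P : A → Set} (P? : ∀ x → Dec (P x)) {xs : List A} → Unique xs →
  (∀ {y z} → y ∈ xs → z ∈ xs → ¬ P y → ¬ P z → y ≡ z) → length xs ≤ suc (length (filter P? xs))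
length≤1+length-filter P? {[]} _ _ = z≤n
length≤1+length-filter {P = P} P? {x ∷ xs} (x∉xs ∷ u) atMostOne with P? x
... | yes _  = s≤s (length≤1+length-filter P? u λ y∈ z∈ → atMostOne (there y∈) (there z∈))
... | no ¬Px = s≤s (≤-reflexive (≡.sym (cong length (filter-all P? (All.tabulate all-P)))))
  where
  all-P : ∀ {y} → y ∈ xs → P y
  all-P {y} y∈ = decidable-stable (P? y) λ ¬Py →
    All.lookup x∉xs y∈ (≡.sym (atMostOne (there y∈) (here refl) ¬Py ¬Px))

module Removal {A : Set} (_≟_ : DecidableEquality A) where

  _∖_ : List A → List A → List A
  xs ∖ []       = xs
  xs ∖ (v ∷ vs) = filter (λ y → ¬? (y ≟ v)) (xs ∖ vs)

  ∖-⊆ : ∀ xs vs → xs ∖ vs ⊆ xs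
  ∖-⊆ _  []       y∈ = y∈
  ∖-⊆ xs (v ∷ vs) y∈ = ∖-⊆ xs vs (proj₁ (∈-filter⁻ (λ y → ¬? (y ≟ v)) {xs = xs ∖ vs} y∈))

  ∖-∉ : ∀ xs vs {y} → y ∈ xs ∖ vs → All (y ≢_) vs
  ∖-∉ _  []       _  = []
  ∖-∉ xs (v ∷ vs) y∈ with ∈-filter⁻ (λ y → ¬? (y ≟ v)) {xs = xs ∖ vs} y∈
  ... | y∈′ , y≢v = y≢v ∷ ∖-∉ xs vs y∈′

  ∖-Unique : ∀ {xs} vs → Unique xs → Unique (xs ∖ vs)
  ∖-Unique []       u = u
  ∖-Unique (v ∷ vs) u = filter⁺ (λ y → ¬? (y ≟ v)) (∖-Unique vs u)

  length-∖ : ∀ {xs} vs → Unique xs → length xs ≤ length vs + length (xs ∖ vs)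
  length-∖ []       _ = ≤-refl
  length-∖ {xs} (v ∷ vs) u = begin
    length xs                                      ≤⟨ length-∖ vs u ⟩
    length vs + length (xs ∖ vs)                   ≤⟨ +-monoʳ-≤ (length vs) removing-v ⟩
    length vs + suc (length (xs ∖ (v ∷ vs)))       ≡⟨ +-suc (length vs) _ ⟩
    suc (length vs + length (xs ∖ (v ∷ vs)))       ∎
    where
    open ≤-Reasoning
    removing-v : length (xs ∖ vs) ≤ suc (length (xs ∖ (v ∷ vs)))
    removing-v =
      length≤1+length-filter (λ y → ¬? (y ≟ v)) (∖-Unique vs u) λ {y} {z} _ _ ¬y≢v ¬z≢v →
      ≡.trans (decidable-stable (y ≟ v) ¬y≢v) (≡.sym (decidable-stable (z ≟ v) ¬z≢v))

  ∃∈-∖ : ∀ {xs} vs → Unique xs → suc (length vs) ≤ length xs → ∃ (_∈ xs ∖ vs)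
  ∃∈-∖ {xs} vs u |vs|<|xs| with xs ∖ vs | length-∖ vs u
  ... | []    | |xs|≤|vs|+0 =
    ⊥-elim (<⇒≱ |vs|<|xs| (≤-trans |xs|≤|vs|+0 (≤-reflexive (+-identityʳ _))))
  ... | y ∷ _ | _           = y , here refl

toList : ∀ {m} → Subset m → List (Fin m)
toList []          = []
toList (true  ∷ p) = zero ∷ map suc (toList p)
toList (false ∷ p) = map suc (toList p)

length-toList : ∀ {m} (p : Subset m) → length (toList p) ≡ ∣ p ∣
length-toList []          = refl
length-toList (true  ∷ p) = cong suc (≡.trans (length-map suc (toList p)) (length-toList p))
length-toList (false ∷ p) = ≡.trans (length-map suc (toList p)) (length-toList p)

∈-toList⁻ : ∀ {m} (p : Subset m) {x} → x ∈ toList p → x ∈ₛ p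
∈-toList⁻ (true ∷ p) (here refl) = here
∈-toList⁻ (true ∷ p) (there x∈) with ∈-map⁻ suc x∈
... | _ , y∈ , refl = there (∈-toList⁻ p y∈)
∈-toList⁻ (false ∷ p) x∈ with ∈-map⁻ suc x∈
... | _ , y∈ , refl = there (∈-toList⁻ p y∈)

toList-Unique : ∀ {m} (p : Subset m) → Unique (toList p)
toList-Unique []          = []
toList-Unique (true  ∷ p) = All.tabulate zero∉ ∷ map⁺ suc-injective (toList-Unique p)
  where
  zero∉ : ∀ {x} → x ∈ map suc (toList p) → zero ≢ x
  zero∉ x∈ refl with ∈-map⁻ suc x∈
  ... | _ , _ , ()
toList-Unique (false ∷ p) = map⁺ suc-injective (toList-Unique p)

module _ {n : ℕ} (G : Graph n) where

  Independent : List (Fin n) → Set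
  Independent xs = ∀ {x y} → x ∈ xs → y ∈ xs → ¬ Adj G x y

  Independent-∷ : ∀ {x xs} → (∀ {y} → y ∈ xs → ¬ Adj G x y) → Independent xs → Independent (x ∷ xs)
  Independent-∷ _   _   (here refl) (here refl) = irrefl G
  Independent-∷ x≁  _   (here refl) (there y∈)  = x≁ y∈
  Independent-∷ x≁  _   (there y∈)  (here refl) = x≁ y∈ ∘ sym G
  Independent-∷ _   ind (there x∈)  (there y∈)  = ind x∈ y∈

  MaxDegree≤1 : List (Fin n) → Set
  MaxDegree≤1 xs = ∀ {x y z} → x ∈ xs → y ∈ xs → z ∈ xs → Adj G x y → Adj G x z → y ≡ z

  MaxDegree≤1-⊆ : ∀ {xs ys} → ys ⊆ xs → MaxDegree≤1 xs → MaxDegree≤1 ys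
  MaxDegree≤1-⊆ ys⊆xs deg x∈ y∈ z∈ = deg (ys⊆xs x∈) (ys⊆xs y∈) (ys⊆xs z∈)

  IsOpenPacking : List (Fin n) → Set
  IsOpenPacking xs = ∀ {x y z} → x ∈ xs → y ∈ xs → Adj G x z → Adj G y z → x ≡ y

  IsOpenPacking⇒MaxDegree≤1 : ∀ {xs} → IsOpenPacking xs → MaxDegree≤1 xs
  IsOpenPacking⇒MaxDegree≤1 packing _ y∈ z∈ xy xz = packing y∈ z∈ (sym G xy) (sym G xz)

  toList-IsOpenPacking : ∀ {S} → OpenPacking G S → IsOpenPacking (toList S)
  toList-IsOpenPacking {S} packing {x} {y} {z} x∈ y∈ xz yz with x ≟ y
  ... | yes x≡y = x≡y
  ... | no  x≢y = ⊥-elim (packing x y (∈-toList⁻ S x∈) (∈-toList⁻ S y∈) x≢y z (xz , yz))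

  Reach-crosses : ∀ {T : Fin n → Set} → (∀ y → Dec (T y)) → ∀ {x y} → Reach G x y → T x → ¬ T y →
    ∃₂ λ a c → T a × ¬ T c × Adj G a c
  Reach-crosses T? here               Tx ¬Ty = ⊥-elim (¬Ty Tx)
  Reach-crosses T? (step {x} {z} xz p) Tx ¬Ty with T? z
  ... | yes Tz = Reach-crosses T? p Tz ¬Ty
  ... | no ¬Tz = x , z , Tx , ¬Tz , xz

  record Detached (a b x : Fin n) : Set where
    field
      ≢a : x ≢ a
      ≢b : x ≢ b
      ≁a : ¬ Adj G x a
      ≁b : ¬ Adj G x b

  K2∪rK1-induced : ∀ {r a b} (I : List (Fin n)) → Adj G a b → Unique I → Independent I →
    All (Detached a b) I → r ≤ length I → InducedSubgraph (K2∪rK1 r) G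
  K2∪rK1-induced {r} {a} {b} I ab unique independent detached r≤|I| =
    f , (λ {x} {y} → f-injective x y) , λ x y → f-preserves , f-reflects x y
    where
    pick : Fin r → Fin n
    pick i = lookup I (inject≤ i r≤|I|)

    pick∈I : ∀ i → pick i ∈ I
    pick∈I i = ∈-lookup (inject≤ i r≤|I|)

    open Detached
    pick-detached : ∀ i → Detached a b (pick i)
    pick-detached i = All.lookup detached (pick∈I i)

    f : Fin (2 + r) → Fin n
    f zero          = a
    f (suc zero)    = b
    f (suc (suc i)) = pick i

    a≢b : a ≢ b
    a≢b refl = irrefl G ab

    f-injective : ∀ x y → f x ≡ f y → x ≡ y
    f-injective zero          zero          _ = refl
    f-injective zero          (suc zero)    e = ⊥-elim (a≢b e)
    f-injective zero          (suc (suc j)) e = ⊥-elim (≢a (pick-detached j) (≡.sym e))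
    f-injective (suc zero)    zero          e = ⊥-elim (a≢b (≡.sym e))
    f-injective (suc zero)    (suc zero)    _ = refl
    f-injective (suc zero)    (suc (suc j)) e = ⊥-elim (≢b (pick-detached j) (≡.sym e))
    f-injective (suc (suc i)) zero          e = ⊥-elim (≢a (pick-detached i) e)
    f-injective (suc (suc i)) (suc zero)    e = ⊥-elim (≢b (pick-detached i) e)
    f-injective (suc (suc i)) (suc (suc j)) e =
      cong (λ k → suc (suc k)) (inject≤-injective r≤|I| r≤|I| i j (lookup-injective unique _ _ e))

    f-preserves : ∀ {x y} → K2rK1-Adj x y → Adj G (f x) (f y)
    f-preserves e01 = ab
    f-preserves e10 = sym G ab

    f-reflects : ∀ x y → Adj G (f x) (f y) → K2rK1-Adj x y
    f-reflects zero          zero          e = ⊥-elim (irrefl G e)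
    f-reflects zero          (suc zero)    _ = e01
    f-reflects zero          (suc (suc j)) e = ⊥-elim (≁a (pick-detached j) (sym G e))
    f-reflects (suc zero)    zero          _ = e10
    f-reflects (suc zero)    (suc zero)    e = ⊥-elim (irrefl G e)
    f-reflects (suc zero)    (suc (suc j)) e = ⊥-elim (≁b (pick-detached j) (sym G e))
    f-reflects (suc (suc i)) zero          e = ⊥-elim (≁a (pick-detached i) e)
    f-reflects (suc (suc i)) (suc zero)    e = ⊥-elim (≁b (pick-detached i) e)
    f-reflects (suc (suc i)) (suc (suc j)) e = ⊥-elim (independent (pick∈I i) (pick∈I j) e)

module _ {n : ℕ} (G : Graph n) (adj? : Decidable (Adj G)) where

  private
    nonNeighbours : Fin n → List (Fin n) → List (Fin n)
    nonNeighbours x = filter (λ y → ¬? (adj? x y))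

    greedy : ℕ → List (Fin n) → List (Fin n)
    greedy zero    _        = []
    greedy (suc k) []       = []
    greedy (suc k) (x ∷ xs) = x ∷ greedy k (nonNeighbours x xs)

    ∈-nonNeighbours⁻ : ∀ x xs {y} → y ∈ nonNeighbours x xs → y ∈ xs × ¬ Adj G x y
    ∈-nonNeighbours⁻ x _ = ∈-filter⁻ (λ y → ¬? (adj? x y))

    greedy-⊆ : ∀ k xs → greedy k xs ⊆ xs
    greedy-⊆ (suc k) (x ∷ xs) (here refl) = here refl
    greedy-⊆ (suc k) (x ∷ xs) (there y∈)  = there (proj₁ (∈-nonNeighbours⁻ x xs (greedy-⊆ k _ y∈)))

    greedy-Unique : ∀ k {xs} → Unique xs → Unique (greedy k xs)
    greedy-Unique zero    _            = []
    greedy-Unique (suc k) {[]} []      = []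
    greedy-Unique (suc k) {x ∷ xs} (x∉xs ∷ u) =
      All.tabulate (λ y∈ → All.lookup x∉xs (proj₁ (∈-nonNeighbours⁻ x xs (greedy-⊆ k _ y∈))))
      ∷ greedy-Unique k (filter⁺ _ u)

    greedy-Independent : ∀ k xs → Independent G (greedy k xs)
    greedy-Independent zero    _        ()
    greedy-Independent (suc k) []       ()
    greedy-Independent (suc k) (x ∷ xs) =
      Independent-∷ G (λ y∈ → proj₂ (∈-nonNeighbours⁻ x xs (greedy-⊆ k _ y∈))) (greedy-Independent k _)

    -- Each step discards at most one vertex besides the one it keeps.
    greedy-length : ∀ k {xs} → MaxDegree≤1 G xs → Unique xs → length xs ≤ k →
      length xs ≤ length (greedy k xs) + length (greedy k xs)
    greedy-length zero    {[]}     _   _          _           = z≤n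
    greedy-length (suc k) {[]}     _   _          _           = z≤n
    greedy-length (suc k) {x ∷ xs} deg (x∉xs ∷ u) (s≤s |xs|≤k) = begin
      suc (length xs)          ≤⟨ s≤s (length≤1+length-filter (λ y → ¬? (adj? x y)) u at-most-one) ⟩
      suc (suc (length rest))  ≤⟨ s≤s (s≤s (greedy-length k deg-rest (filter⁺ _ u) |rest|≤k)) ⟩
      suc (suc (g + g))        ≡⟨ cong suc (≡.sym (+-suc g g)) ⟩
      suc g + suc g            ∎
      where
      open ≤-Reasoning
      rest = nonNeighbours x xs
      g = length (greedy k rest)
      at-most-one : ∀ {y z} → y ∈ xs → z ∈ xs → ¬ ¬ Adj G x y → ¬ ¬ Adj G x z → y ≡ z
      at-most-one {y} {z} y∈ z∈ ¬¬xy ¬¬xz = deg (here refl) (there y∈) (there z∈)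
        (decidable-stable (adj? x y) ¬¬xy) (decidable-stable (adj? x z) ¬¬xz)
      deg-rest : MaxDegree≤1 G rest
      deg-rest = MaxDegree≤1-⊆ G (λ y∈ → there (proj₁ (∈-nonNeighbours⁻ x xs y∈))) deg
      |rest|≤k : length rest ≤ k
      |rest|≤k = ≤-trans (length-filter _ xs) |xs|≤k

  independent-half : ∀ {xs} → MaxDegree≤1 G xs → Unique xs →
    ∃ λ J → J ⊆ xs × Unique J × Independent G J × length xs ≤ length J + length J
  independent-half {xs} deg u =
    greedy (length xs) xs , greedy-⊆ _ xs , greedy-Unique _ u , greedy-Independent _ xs ,
    greedy-length _ deg u ≤-refl

module _ {n : ℕ} (G : Graph n) (adj? : Decidable (Adj G)) (connected : Connected G)
  {r : ℕ} (free : Free (K2∪rK1 r) G)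
  {E : List (Fin n)} (E-unique : Unique E) (E-packing : IsOpenPacking G E)
  (2+r≤|E| : 2 + r ≤ length E) (r+r≤1+|E| : r + r ≤ suc (length E)) where

  open Removal (_≟_ {n})
  open import Data.List.Membership.DecPropositional (_≟_ {n}) using (_∈?_)
  neighbour-unshared : ∀ {x y z} → x ∈ E → y ∈ E → Adj G x z → y ≢ x → ¬ Adj G y z
  neighbour-unshared x∈ y∈ xz y≢x yz = y≢x (E-packing y∈ x∈ yz xz)

  edges-with-exit⇒⊥ : ∀ {u v p q c} → u ∈ E → v ∈ E → p ∈ E → q ∈ E → Adj G u v → Adj G p q →
    p ≢ u → p ≢ v → q ≢ u → q ≢ v → Adj G p c → c ≢ q → ⊥
  edges-with-exit⇒⊥ {u} {v} {p} {q} {c} u∈ v∈ p∈ q∈ uv pq p≢u p≢v q≢u q≢v pc c≢q =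
    let J , J⊆ , J-unique , J-independent , |rest|≤|J|+|J| = independent-half G adj? deg-rest rest-unique
    in  free (K2∪rK1-induced G (c ∷ q ∷ J) uv (unique J⊆ J-unique) (independent J⊆ J-independent)
               (c-detached ∷ detached-from-uv q∈ q≢u q≢v ∷ All.tabulate (J-detached J⊆))
               (r≤2+|J| J⊆ |rest|≤|J|+|J|))
    where
    removed : List (Fin n)
    removed = u ∷ v ∷ p ∷ q ∷ []

    rest : List (Fin n)
    rest = E ∖ removed

    rest-unique : Unique rest
    rest-unique = ∖-Unique removed E-unique

    deg-rest : MaxDegree≤1 G rest
    deg-rest = MaxDegree≤1-⊆ G (∖-⊆ E removed) (IsOpenPacking⇒MaxDegree≤1 G E-packing)

    rest-info : ∀ {y} → y ∈ rest → y ∈ E × y ≢ u × y ≢ v × y ≢ p × y ≢ q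
    rest-info y∈ with ∖-∉ E removed y∈
    ... | y≢u ∷ y≢v ∷ y≢p ∷ y≢q ∷ [] = ∖-⊆ E removed y∈ , y≢u , y≢v , y≢p , y≢q

    q≢p : q ≢ p
    q≢p refl = irrefl G pq

    c∉E : c ∈ E → ⊥
    c∉E c∈ = neighbour-unshared q∈ c∈ (sym G pq) c≢q (sym G pc)

    detached-from-uv : ∀ {y} → y ∈ E → y ≢ u → y ≢ v → Detached G u v y
    detached-from-uv y∈ y≢u y≢v = record
      { ≢a = y≢u ; ≢b = y≢v
      ; ≁a = neighbour-unshared v∈ y∈ (sym G uv) y≢v
      ; ≁b = neighbour-unshared u∈ y∈ uv y≢u }

    c-detached : Detached G u v c
    c-detached = record
      { ≢a = λ { refl → c∉E u∈ } ; ≢b = λ { refl → c∉E v∈ }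
      ; ≁a = λ cu → neighbour-unshared p∈ u∈ pc (p≢u ∘ ≡.sym) (sym G cu)
      ; ≁b = λ cv → neighbour-unshared p∈ v∈ pc (p≢v ∘ ≡.sym) (sym G cv) }

    module _ {J : List (Fin n)} (J⊆ : J ⊆ rest) where

      J-detached : ∀ {y} → y ∈ J → Detached G u v y
      J-detached y∈ = let y∈E , y≢u , y≢v , _ = rest-info (J⊆ y∈) in detached-from-uv y∈E y≢u y≢v

      unique : Unique J → Unique (c ∷ q ∷ J)
      unique J-unique = (c≢q ∷ All.tabulate c≢J) ∷ All.tabulate q≢J ∷ J-unique
        where
        c≢J : ∀ {y} → y ∈ J → c ≢ y
        c≢J y∈ refl = c∉E (proj₁ (rest-info (J⊆ y∈)))
        q≢J : ∀ {y} → y ∈ J → q ≢ y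
        q≢J y∈ refl = let _ , _ , _ , _ , y≢q = rest-info (J⊆ y∈) in y≢q refl

      -- c and q are neighbours of p, hence adjacent to no other member of E.
      independent : Independent G J → Independent G (c ∷ q ∷ J)
      independent J-independent = Independent-∷ G c≁ (Independent-∷ G q≁ J-independent)
        where
        p-neighbour-≁ : ∀ {y z} → Adj G p z → y ∈ J → ¬ Adj G z y
        p-neighbour-≁ pz y∈ zy =
          let y∈E , _ , _ , y≢p , _ = rest-info (J⊆ y∈) in neighbour-unshared p∈ y∈E pz y≢p (sym G zy)
        c≁ : ∀ {y} → y ∈ q ∷ J → ¬ Adj G c y
        c≁ (here refl) cq = neighbour-unshared p∈ q∈ pc q≢p (sym G cq)
        c≁ (there y∈)     = p-neighbour-≁ pc y∈
        q≁ : ∀ {y} → y ∈ J → ¬ Adj G q y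
        q≁ = p-neighbour-≁ pq

      r≤2+|J| : length rest ≤ length J + length J → r ≤ 2 + length J
      r≤2+|J| |rest|≤|J|+|J| = m+m≤1+n+n⇒m≤n r (2 + length J) (begin
        r + r                       ≤⟨ r+r≤1+|E| ⟩
        suc (length E)              ≤⟨ s≤s (length-∖ removed E-unique) ⟩
        suc (4 + length rest)       ≤⟨ s≤s (+-monoʳ-≤ 4 |rest|≤|J|+|J|) ⟩
        suc (4 + (j + j))           ≡⟨ cong suc (regroup j) ⟩
        suc ((2 + j) + (2 + j))     ∎)
        where
        open ≤-Reasoning
        j : ℕ
        j = length J
        regroup : ∀ j → 4 + (j + j) ≡ (2 + j) + (2 + j)
        regroup = solve-∀

  disjoint-edges⇒⊥ : ∀ {u v p q} → u ∈ E → v ∈ E → p ∈ E → q ∈ E → Adj G u v → Adj G p q →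
    p ≢ u → p ≢ v → ⊥
  disjoint-edges⇒⊥ {u} {v} {p} {q} u∈ v∈ p∈ q∈ uv pq p≢u p≢v =
    from-crossing (Reach-crosses G (_∈? (p ∷ q ∷ [])) (connected p u) (here refl) u∉pq)
    where
    q≢u : q ≢ u
    q≢u refl = neighbour-unshared v∈ p∈ (sym G uv) p≢v pq
    q≢v : q ≢ v
    q≢v refl = neighbour-unshared u∈ p∈ uv p≢u pq
    u∉pq : ¬ u ∈ p ∷ q ∷ []
    u∉pq (here refl)         = p≢u refl
    u∉pq (there (here refl)) = q≢u refl
    from-crossing : (∃₂ λ a c → a ∈ p ∷ q ∷ [] × ¬ c ∈ p ∷ q ∷ [] × Adj G a c) → ⊥
    from-crossing (_ , c , here refl , c∉ , pc) =
      edges-with-exit⇒⊥ u∈ v∈ p∈ q∈ uv pq p≢u p≢v q≢u q≢v pc (λ c≡q → c∉ (there (here c≡q)))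
    from-crossing (_ , c , there (here refl) , c∉ , qc) =
      edges-with-exit⇒⊥ u∈ v∈ q∈ p∈ uv (sym G pq) q≢u q≢v p≢u p≢v qc (c∉ ∘ here)

  isolated⇒⊥ : ∀ {w} → w ∈ E → (∀ {y} → y ∈ E → ¬ Adj G w y) → ⊥
  isolated⇒⊥ {w} w∈ w-isolated =
    without-w-and y λ x∈ z∈ → edge⇒⊥ (∖-⊆ E (w ∷ y ∷ []) x∈) (∖-⊆ E (w ∷ y ∷ []) z∈)
    where
    y∈E∖w : ∃ (_∈ E ∖ (w ∷ []))
    y∈E∖w = ∃∈-∖ (w ∷ []) E-unique (≤-trans (s≤s (s≤s z≤n)) 2+r≤|E|)

    y : Fin n
    y = proj₁ y∈E∖w

    w-exit : ∃₂ λ a c → a ≡ w × c ≢ w × Adj G a c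
    w-exit with ∖-∉ E (w ∷ []) (proj₂ y∈E∖w)
    ... | y≢w ∷ [] = Reach-crosses G (_≟ w) (connected w y) refl y≢w

    c : Fin n
    c = proj₁ (proj₂ w-exit)

    wc : Adj G w c
    wc with w-exit
    ... | _ , _ , refl , _ , wc = wc

    without-w-and : ∀ v → Independent G (E ∖ (w ∷ v ∷ [])) → ⊥
    without-w-and v independent =
      free (K2∪rK1-induced G (E ∖ (w ∷ v ∷ [])) wc (∖-Unique (w ∷ v ∷ []) E-unique) independent
              (All.tabulate detached)
              (+-cancelˡ-≤ 2 _ _ (≤-trans 2+r≤|E| (length-∖ (w ∷ v ∷ []) E-unique))))
      where
      detached : ∀ {x} → x ∈ E ∖ (w ∷ v ∷ []) → Detached G w c x
      detached {x} x∈ with ∖-∉ E (w ∷ v ∷ []) x∈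
      ... | x≢w ∷ _ = record
        { ≢a = x≢w
        ; ≢b = λ { refl → w-isolated x∈E wc }
        ; ≁a = w-isolated x∈E ∘ sym G
        ; ≁b = neighbour-unshared w∈ x∈E wc x≢w }
        where x∈E = ∖-⊆ E (w ∷ v ∷ []) x∈

    edge⇒⊥ : ∀ {u v} → u ∈ E → v ∈ E → ¬ Adj G u v
    edge⇒⊥ {u} {v} u∈ v∈ uv = without-w-and v independent
      where
      independent : Independent G (E ∖ (w ∷ v ∷ []))
      independent {x} {z} x∈ z∈ xz with ∖-∉ E (w ∷ v ∷ []) x∈ | ∖-∉ E (w ∷ v ∷ []) z∈
      ... | _ ∷ x≢v ∷ [] | _ ∷ z≢v ∷ [] =
        disjoint-edges⇒⊥ u∈ v∈ (∖-⊆ E (w ∷ v ∷ []) x∈) (∖-⊆ E (w ∷ v ∷ []) z∈) uv xz x≢u x≢v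
        where
        x≢u : x ≢ u
        x≢u refl = z≢v (E-packing (∖-⊆ E (w ∷ v ∷ []) z∈) v∈ (sym G xz) (sym G uv))

  has-neighbour : ∀ {x} → x ∈ E → ∃ λ p → p ∈ E × Adj G x p
  has-neighbour {x} x∈ with any? (adj? x) E
  ... | yes some = find some
  ... | no  none = ⊥-elim (isolated⇒⊥ x∈ λ y∈ xy → none (lose y∈ xy))

  large-open-packing⇒⊥ : 0 < r → ⊥
  large-open-packing⇒⊥ 0<r =
    let x , x∈ = ∃∈-∖ [] E-unique (≤-trans (s≤s z≤n) 2+r≤|E|)
        p , p∈ , xp = has-neighbour x∈
    in  second-edge x∈ p∈ xp
    where
    second-edge : ∀ {x p} → x ∈ E → p ∈ E → Adj G x p → ⊥
    second-edge {x} {p} x∈ p∈ xp with ∃∈-∖ (x ∷ p ∷ []) E-unique (≤-trans (+-monoʳ-≤ 2 0<r) 2+r≤|E|)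
    ... | y , y∈ with ∖-∉ E (x ∷ p ∷ []) y∈ | has-neighbour (∖-⊆ E (x ∷ p ∷ []) y∈)
    ...   | y≢x ∷ y≢p ∷ [] | q , q∈ , yq =
      disjoint-edges⇒⊥ x∈ p∈ (∖-⊆ E (x ∷ p ∷ []) y∈) q∈ xp yq y≢x y≢p

above-max-bound : ∀ {r s} → 0 < r → (r + 1) ⊔ (2 * (r ∸ 1)) < s → 2 + r ≤ s × r + r ≤ suc s
above-max-bound {suc k} {s} _ bound<s =
  subst (_≤ s) (regroup₁ k) (m⊔n<o⇒m<o (suc k + 1) (2 * k) bound<s) ,
  subst (_≤ suc s) (regroup₂ k) (s≤s (m⊔n<o⇒n<o (suc k + 1) (2 * k) bound<s))
  where
  regroup₁ : ∀ k → suc (suc k + 1) ≡ 2 + suc k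
  regroup₁ = solve-∀
  regroup₂ : ∀ k → suc (suc (2 * k)) ≡ suc k + suc k
  regroup₂ = solve-∀

lemma11 : (r : ℕ) → 2 ≤ r → (n : ℕ) → (G : Graph n) →
    Connected G → Free (K2∪rK1 r) G →
    ρᵒ≤ G ((r + 1) ⊔ (2 * (r ∸ 1)))
lemma11 r 2≤r n G connected free S S-packing with ∣ S ∣ ≤? (r + 1) ⊔ (2 * (r ∸ 1))
... | yes bounded = bounded
... | no  unbounded = ⊥-elim (¬¬-decidable-Fin (Adj G) λ adj? →
        large-open-packing⇒⊥ G adj? connected free (toList-Unique S) (toList-IsOpenPacking G S-packing)
          (proj₁ bounds) (proj₂ bounds) 0<r)
  where
  0<r : 0 < r
  0<r = ≤-trans (s≤s z≤n) 2≤r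

  bounds : 2 + r ≤ length (toList S) × r + r ≤ suc (length (toList S))
  bounds rewrite length-toList S = above-max-bound 0<r (≰⇒> unbounded)
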